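{- (1) All the basic rules except ($\bot$) and ($\lor$L) are correct at every Kripke model. (2) ($\bot$) and ($\lor$L) are correct at every $\Box\Diamond^{ -1}$-model.
   Context: Formulas are built from propositional letters and $\bot$ using $\land,\lor,\to$; $\top:=\bot\to\bot$. For a frame $\mathfrak F=\langle W,R\rangle$, $X\subseteq W$: $\Box_{\mathfrak F}X=\{w\mid\forall v(wRv\Rightarrow v\in X)\}$, $\Diamond^{ -1}_{\mathfrak F}X=\{w\mid\exists x\in X,\ xRw\}$, $FP_{\mathfrak F}=\{\Box_{\mathfrak F}X\mid X\subseteq W\}$. In any Kripke model $\mathfrak M=\langle\mathfrak F,V\rangle$ truth sets are: $\|p\|=V(p)$, $\|\bot\|=\Box_{\mathfrak F}\emptyset$, $\|\alpha\land\beta\|=\|\alpha\|\cap\|\beta\|$, $\|\alpha\to\beta\|=\Box_{\mathfrak F}((W\setminus\|\alpha\|)\cup\|\beta\|)$, $\|\alpha\lor\beta\|=\Box_{\mathfrak F}\Diamond^{ -1}_{\mathfrak F}(\|\alpha\|\cup\|\beta\|)$. A $\Box\Diamond^{ -1}$-model is one with $V(p)\in FP_{\mathfrak F}$ for all $p$. For a model $\mathfrak M$, $\Gamma\vDash_{\mathfrak M}\varphi$ iff every point of $\mathfrak M$ satisfying all of $\Gamma$ satisfies $\varphi$; a rule is correct at $\mathfrak M$ iff $\vDash_{\mathfrak M}$ (restricted to single premises, with "$\vDash_{\mathfrak M}\alpha$" meaning $\chi\vDash_{\mathfrak M}\alpha$ for all $\chi$) satisfies it. The basic rules are: (A) $\alpha\vdash\alpha$;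 (Cut) $\alpha\vdash\beta,\beta\vdash\gamma\Rightarrow\alpha\vdash\gamma$; ($\bot$) $\bot\vdash\alpha$; ($\land$R) $\chi\vdash\alpha,\chi\vdash\beta\Rightarrow\chi\vdash\alpha\land\beta$; ($\land$L) $\alpha\land\beta\vdash\alpha$, $\alpha\land\beta\vdash\beta$; ($\lor$R) $\alpha\vdash\alpha\lor\beta$, $\beta\vdash\alpha\lor\beta$; ($\lor$L) $\alpha\vdash\chi,\beta\vdash\chi\Rightarrow\alpha\lor\beta\vdash\chi$; (DT$_0$) $\alpha\vdash\beta\Rightarrow\ \vdash\alpha\to\beta$; ($\to\land$) $(\alpha\to\beta)\land(\alpha\to\gamma)\vdash\alpha\to\beta\land\gamma$; ($\to$tr) $(\alpha\to\beta)\land(\beta\to\gamma)\vdash\alpha\to\gamma$; ($\to$-$\lor$.s) for $n\ge1$, $\bigvee_j(\alpha_j\to\beta_j)\land\bigwedge_j(\psi_j\land\beta_j\to\chi)\vdash\bigwedge_j(\psi_j\land\alpha_j)\to\chi$. -}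

module Defs where

open import Level using (0ℓ)
open import Data.Nat using (ℕ; zero; suc)
open import Data.Fin using (Fin; zero; suc)
open import Data.Product using (Σ; ∃; _×_; _,_)
open import Data.Sum using (_⊎_)
open import Data.Empty using (⊥)
open import Function using (_∘_)
open import Relation.Unary using (Pred; _∈_; _⊆_; _≐_; _∪_; _∩_; ∁; ∅)

data Formula : Set where
  var  : ℕ → Formula
  ⊥'   : Formula
  _∧'_ : Formula → Formula → Formula
  _∨'_ : Formula → Formula → Formula
  _⇒'_ : Formula → Formula → Formula

infixr 6 _∧'_
infixr 5 _∨'_
infixr 4 _⇒'_

⊤' : Formula
⊤' = ⊥' ⇒' ⊥'

⋀ : ∀ {n} → (Fin (suc n) → Formula) → Formula
⋀ {zero}  f = f zero
⋀ {suc n} f = f zero ∧' ⋀ (f ∘ suc)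

⋁ : ∀ {n} → (Fin (suc n) → Formula) → Formula
⋁ {zero}  f = f zero
⋁ {suc n} f = f zero ∨' ⋁ (f ∘ suc)

record Frame : Set₁ where
  field
    W : Set
    R : W → W → Set

module _ (F : Frame) where
  open Frame F

  □ : Pred W 0ℓ → Pred W 0ℓ
  □ X w = ∀ v → R w v → v ∈ X

  ◇⁻¹ : Pred W 0ℓ → Pred W 0ℓ
  ◇⁻¹ X w = ∃ λ x → x ∈ X × R x w

  FP : Pred W 0ℓ → Set₁
  FP X = Σ (Pred W 0ℓ) λ Y → X ≐ □ Y

record Model : Set₁ where
  field
    frame : Frame
    V     : ℕ → Pred (Frame.W frame) 0ℓ

module _ (M : Model) where
  open Model M
  open Frame frame

  ‖_‖ : Formula → Pred W 0ℓ
  ‖ var p ‖   = V p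
  ‖ ⊥' ‖      = □ frame ∅
  ‖ α ∧' β ‖  = ‖ α ‖ ∩ ‖ β ‖
  ‖ α ⇒' β ‖  = □ frame (∁ ‖ α ‖ ∪ ‖ β ‖)
  ‖ α ∨' β ‖  = □ frame (◇⁻¹ frame (‖ α ‖ ∪ ‖ β ‖))

  _⊨_ : Formula → Formula → Set
  χ ⊨ φ = ‖ χ ‖ ⊆ ‖ φ ‖

  ⊨_ : Formula → Set
  ⊨ α = ∀ χ → χ ⊨ α

BoxDiaModel : Model → Set₁
BoxDiaModel M = ∀ p → FP (Model.frame M) (Model.V M p)

module _ (M : Model) where
  private
    _⊢_ = _⊨_ M
    ⊢_ = ⊨_ M
  infix 2 _⊢_

  RuleA : Set
  RuleA = ∀ α → α ⊢ α

  RuleCut : Set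
  RuleCut = ∀ α β γ → α ⊢ β → β ⊢ γ → α ⊢ γ

  Rule⊥ : Set
  Rule⊥ = ∀ α → ⊥' ⊢ α

  Rule∧R : Set
  Rule∧R = ∀ χ α β → χ ⊢ α → χ ⊢ β → χ ⊢ α ∧' β

  Rule∧L : Set
  Rule∧L = ∀ α β → (α ∧' β ⊢ α) × (α ∧' β ⊢ β)

  Rule∨R : Set
  Rule∨R = ∀ α β → (α ⊢ α ∨' β) × (β ⊢ α ∨' β)

  Rule∨L : Set
  Rule∨L = ∀ α β χ → α ⊢ χ → β ⊢ χ → α ∨' β ⊢ χ

  RuleDT₀ : Set
  RuleDT₀ = ∀ α β → α ⊢ β → ⊢ (α ⇒' β)

  Rule⇒∧ : Set
  Rule⇒∧ = ∀ α β γ → (α ⇒' β) ∧' (α ⇒' γ) ⊢ α ⇒' β ∧' γ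

  Rule⇒tr : Set
  Rule⇒tr = ∀ α β γ → (α ⇒' β) ∧' (β ⇒' γ) ⊢ α ⇒' γ

  -- (→-∨.s) for n ≥ 1, indices j ∈ Fin (suc n)
  Rule⇒∨s : Set
  Rule⇒∨s = ∀ n (α β ψ : Fin (suc n) → Formula) (χ : Formula) →
    ⋁ (λ j → α j ⇒' β j) ∧' ⋀ (λ j → ψ j ∧' β j ⇒' χ)
      ⊢ ⋀ (λ j → ψ j ∧' α j) ⇒' χ

{-# OPTIONS --safe #-}
module Submission where

-- The operators □ and ◇⁻¹ form a Galois connection (◇⁻¹ X ⊆ Y iff X ⊆ □ Y), so
-- □◇⁻¹ is a closure operator whose closed sets include every □ Y.  Conjunction,
-- ∨-introduction, and the rules for ⇒ are then pointwise reasoning under a □;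
-- only DT₀ and (→-∨.s) need excluded middle, to split on whether the
-- antecedent holds.  In a □◇⁻¹-model every truth set is closed: letters by
-- assumption, ⊥, ∨, ⇒ because they are of the form □ Y, and ∧ because closed
-- sets are stable under ∩.  Since ‖ α ∨ β ‖ and ‖ ⊥ ‖ are □◇⁻¹ of ‖ α ‖ ∪ ‖ β ‖
-- and of ∅, minimality of the closure gives (∨L) and (⊥).

open import Defs
open import Level using (0ℓ)
open import Data.Product using (_×_; _,_; proj₁; proj₂)
open import Data.Sum using (_⊎_; inj₁; inj₂; [_,_])
open import Data.Nat using (zero; suc)
open import Data.Fin using (Fin; zero; suc)
open import Data.Empty using (⊥-elim)
open import Function using (_∘_)
open import Relation.Nullary using (¬_; yes; no)
open import Relation.Unary using (Pred; _∈_; _⊆_; _∪_; _∩_; ∁; ⋃; ⋂)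
open import Axiom.ExcludedMiddle using (ExcludedMiddle)

private variable
  P Q R : Set

¬⊎-mp : ¬ P ⊎ Q → P → Q
¬⊎-mp (inj₁ ¬p) p = ⊥-elim (¬p p)
¬⊎-mp (inj₂ q)  _ = q

¬⊎-× : (¬ P ⊎ Q) × (¬ P ⊎ R) → ¬ P ⊎ (Q × R)
¬⊎-× (inj₁ ¬p , _)       = inj₁ ¬p
¬⊎-× (inj₂ _  , inj₁ ¬p) = inj₁ ¬p
¬⊎-× (inj₂ q  , inj₂ r)  = inj₂ (q , r)

¬⊎-trans : (¬ P ⊎ Q) × (¬ Q ⊎ R) → ¬ P ⊎ R
¬⊎-trans (inj₁ ¬p , _)   = inj₁ ¬p
¬⊎-trans (inj₂ q  , q⇒r) = inj₂ (¬⊎-mp q⇒r q)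

→⇒¬⊎ : ExcludedMiddle 0ℓ → (P → Q) → ¬ P ⊎ Q
→⇒¬⊎ {P = P} em p⇒q with em {P}
... | yes p  = inj₂ (p⇒q p)
... | no  ¬p = inj₁ ¬p

module Closure (F : Frame) where
  open Frame F

  private variable
    X Y : Pred W 0ℓ

  □-mono : X ⊆ Y → □ F X ⊆ □ F Y
  □-mono X⊆Y w∈□X v wRv = X⊆Y (w∈□X v wRv)

  ◇⁻¹-mono : X ⊆ Y → ◇⁻¹ F X ⊆ ◇⁻¹ F Y
  ◇⁻¹-mono X⊆Y (x , x∈X , xRw) = x , X⊆Y x∈X , xRw

  □◇⁻¹-mono : X ⊆ Y → □ F (◇⁻¹ F X) ⊆ □ F (◇⁻¹ F Y)
  □◇⁻¹-mono = □-mono ∘ ◇⁻¹-mono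

  □-∩ : □ F X ∩ □ F Y ⊆ □ F (X ∩ Y)
  □-∩ (w∈□X , w∈□Y) v wRv = w∈□X v wRv , w∈□Y v wRv

  ⊆-□◇⁻¹ : X ⊆ □ F (◇⁻¹ F X)
  ⊆-□◇⁻¹ {x = w} w∈X v wRv = w , w∈X , wRv

  ◇⁻¹□-⊆ : ◇⁻¹ F (□ F X) ⊆ X
  ◇⁻¹□-⊆ (x , x∈□X , xRw) = x∈□X _ xRw

  Closed : Pred W 0ℓ → Set
  Closed X = □ F (◇⁻¹ F X) ⊆ X

  □-closed : Closed (□ F X)
  □-closed = □-mono ◇⁻¹□-⊆

  ∩-closed : Closed X → Closed Y → Closed (X ∩ Y)
  ∩-closed X-closed Y-closed w∈ =
    X-closed (□◇⁻¹-mono proj₁ w∈) , Y-closed (□◇⁻¹-mono proj₂ w∈)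

  □◇⁻¹-least : Closed Y → X ⊆ Y → □ F (◇⁻¹ F X) ⊆ Y
  □◇⁻¹-least Y-closed X⊆Y = Y-closed ∘ □◇⁻¹-mono X⊆Y

  FP-closed : FP F X → Closed X
  FP-closed (Y , X⊆□Y , □Y⊆X) = □Y⊆X ∘ □◇⁻¹-least □-closed X⊆□Y

  frame-⇒∨s : ExcludedMiddle 0ℓ → {I : Set} (A B P : I → Pred W 0ℓ) {Q C : Pred W 0ℓ} →
    Q ⊆ ⋂ I (λ j → P j ∩ A j) →
    □ F (◇⁻¹ F (⋃ I λ j → □ F (∁ (A j) ∪ B j))) ∩ ⋂ I (λ j → □ F (∁ (P j ∩ B j) ∪ C))
      ⊆ □ F (∁ Q ∪ C)
  frame-⇒∨s em A B P {Q} Q⊆⋂ (w∈□◇⁻¹⋃ , w∈⋂) v wRv with em {v ∈ Q}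
  ... | no v∉Q = inj₁ v∉Q
  ... | yes v∈Q with w∈□◇⁻¹⋃ v wRv
  ... | x , (j , x∈□A⇒B) , xRv =
    let (v∈P , v∈A) = Q⊆⋂ v∈Q j
        v∈B        = ¬⊎-mp (x∈□A⇒B v xRv) v∈A
    in inj₂ (¬⊎-mp (w∈⋂ j v wRv) (v∈P , v∈B))

module _ (M : Model) where
  open Model M
  open Closure frame

  ‖⋀‖⊆⋂ : ∀ {n} (f : Fin (suc n) → Formula) → ‖ M ‖ (⋀ f) ⊆ ⋂ (Fin (suc n)) (‖ M ‖ ∘ f)
  ‖⋀‖⊆⋂ {zero}  f x∈f₀        zero    = x∈f₀
  ‖⋀‖⊆⋂ {suc n} f (x∈f₀ , _)  zero    = x∈f₀
  ‖⋀‖⊆⋂ {suc n} f (_ , x∈⋀f₊) (suc j) = ‖⋀‖⊆⋂ (f ∘ suc) x∈⋀f₊ j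

  ‖⋁‖⊆□◇⁻¹⋃ : ∀ {n} (f : Fin (suc n) → Formula) →
    ‖ M ‖ (⋁ f) ⊆ □ frame (◇⁻¹ frame (⋃ (Fin (suc n)) (‖ M ‖ ∘ f)))
  ‖⋁‖⊆□◇⁻¹⋃ {zero}  f = ⊆-□◇⁻¹ ∘ (zero ,_)
  ‖⋁‖⊆□◇⁻¹⋃ {suc n} f = □◇⁻¹-least □-closed
    [ ⊆-□◇⁻¹ ∘ (zero ,_)
    , □◇⁻¹-mono (λ (j , x∈fj) → suc j , x∈fj) ∘ ‖⋁‖⊆□◇⁻¹⋃ (f ∘ suc) ]

  ruleA-correct : RuleA M
  ruleA-correct α x∈α = x∈α

  ruleCut-correct : RuleCut M
  ruleCut-correct α β γ α⊨β β⊨γ = β⊨γ ∘ α⊨β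

  rule∧R-correct : Rule∧R M
  rule∧R-correct χ α β χ⊨α χ⊨β x∈χ = χ⊨α x∈χ , χ⊨β x∈χ

  rule∧L-correct : Rule∧L M
  rule∧L-correct α β = proj₁ , proj₂

  rule∨R-correct : Rule∨R M
  rule∨R-correct α β = ⊆-□◇⁻¹ ∘ inj₁ , ⊆-□◇⁻¹ ∘ inj₂

  ruleDT₀-correct : ExcludedMiddle 0ℓ → RuleDT₀ M
  ruleDT₀-correct em α β α⊨β χ _ v _ = →⇒¬⊎ em α⊨β

  rule⇒∧-correct : Rule⇒∧ M
  rule⇒∧-correct α β γ = □-mono ¬⊎-× ∘ □-∩

  rule⇒tr-correct : Rule⇒tr M
  rule⇒tr-correct α β γ = □-mono ¬⊎-trans ∘ □-∩

  rule⇒∨s-correct : ExcludedMiddle 0ℓ → Rule⇒∨s M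
  rule⇒∨s-correct em n α β ψ χ (w∈⋁ , w∈⋀) =
    frame-⇒∨s em (‖ M ‖ ∘ α) (‖ M ‖ ∘ β) (‖ M ‖ ∘ ψ)
      (‖⋀‖⊆⋂ (λ j → ψ j ∧' α j))
      (‖⋁‖⊆□◇⁻¹⋃ (λ j → α j ⇒' β j) w∈⋁ , ‖⋀‖⊆⋂ (λ j → ψ j ∧' β j ⇒' χ) w∈⋀)

  module _ (□◇⁻¹-model : BoxDiaModel M) where

    truth-closed : ∀ φ → Closed (‖ M ‖ φ)
    truth-closed (var p)  = FP-closed (□◇⁻¹-model p)
    truth-closed ⊥'       = □-closed
    truth-closed (φ ∧' ψ) = ∩-closed (truth-closed φ) (truth-closed ψ)
    truth-closed (φ ∨' ψ) = □-closed
    truth-closed (φ ⇒' ψ) = □-closed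

    rule⊥-correct : Rule⊥ M
    rule⊥-correct α = truth-closed α ∘ □-mono (λ ())

    rule∨L-correct : Rule∨L M
    rule∨L-correct α β χ α⊨χ β⊨χ = □◇⁻¹-least (truth-closed χ) [ α⊨χ , β⊨χ ]

lemma5 : ExcludedMiddle 0ℓ →
    ((M : Model) →
      RuleA M × RuleCut M × Rule∧R M × Rule∧L M × Rule∨R M ×
      RuleDT₀ M × Rule⇒∧ M × Rule⇒tr M × Rule⇒∨s M)
    × ((M : Model) → BoxDiaModel M → Rule⊥ M × Rule∨L M)
lemma5 em =
    (λ M → ruleA-correct M , ruleCut-correct M , rule∧R-correct M , rule∧L-correct M
         , rule∨R-correct M , ruleDT₀-correct M em , rule⇒∧-correct M
         , rule⇒tr-correct M , rule⇒∨s-correct M em)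
  , (λ M □◇⁻¹-model → rule⊥-correct M □◇⁻¹-model , rule∨L-correct M □◇⁻¹-model)
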